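{- Let $n,m$ be positive integers with $n \le 2^{m-1}-1$. Then $g(n,m)\ge 2n$.
   Context: Write $[m]=\{1,\ldots,m\}$. For a multiset $\mathcal{F}=\{C_1,\ldots,C_k\}$ of non-empty subsets of $[m]$ (repetitions allowed; members indexed by $[k]$), a resolution into $n$ classes is a partition $\{A_1,\ldots,A_n\}$ of $[k]$ into $n$ blocks such that for each $i$ the sets $C_j$, $j\in A_i$, are pairwise disjoint with union $[m]$. $\mathcal{F}$ is uniquely resolvable with respect to $(n,m)$ if it has exactly one resolution into $n$ classes (partitions regarded as unordered). $g(n,m)$ is the maximum size $k$ of a uniquely resolvable multiset with respect to $(n,m)$. -}

module Defs where

open import Data.Nat using (ℕ; suc; _≤_; _∸_; _^_; _*_)
open import Data.Fin using (Fin)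
open import Data.Fin.Subset using (Subset; _∈_; _∩_; Empty; Nonempty)
open import Data.Product using (Σ; ∃; _×_)
open import Relation.Binary.PropositionalEquality using (_≡_; _≢_)
open import Function.Bundles using (_⇔_)

-- A multiset F = {C_1,...,C_k} of subsets of [m], members indexed by Fin k.
Family : ℕ → ℕ → Set
Family m k = Fin k → Subset m

NonemptyMembers : ∀ {m k} → Family m k → Set
NonemptyMembers F = ∀ j → Nonempty (F j)

-- A partition of [k] into n (non-empty) blocks, given by a surjective
-- block-labelling c : Fin k → Fin n  (block A_i = c ⁻¹ {i}).
Surjective : ∀ {k n} → (Fin k → Fin n) → Set
Surjective {k} c = ∀ i → ∃ λ j → c j ≡ i

IsResolution : ∀ {m k} n → Family m k → (Fin k → Fin n) → Set
IsResolution {m} {k} n F c =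
  Surjective c ×
  (∀ (i : Fin n) →
     (∀ (j j′ : Fin k) → j ≢ j′ → c j ≡ i → c j′ ≡ i → Empty (F j ∩ F j′)) ×
     (∀ (x : Fin m) → ∃ λ j → c j ≡ i × x ∈ F j))

-- Two labellings define the same (unordered) partition iff they induce the
-- same equivalence relation "lies in the same block".
SamePartition : ∀ {k n} → (Fin k → Fin n) → (Fin k → Fin n) → Set
SamePartition {k} c c′ = ∀ (j j′ : Fin k) → (c j ≡ c j′) ⇔ (c′ j ≡ c′ j′)

UniquelyResolvable : ∀ {m k} n → Family m k → Set
UniquelyResolvable {m} {k} n F =
  NonemptyMembers F ×
  (Σ (Fin k → Fin n) λ c → IsResolution n F c ×
     (∀ c′ → IsResolution n F c′ → SamePartition c c′))

-- "g(n,m) ≥ N": some uniquely resolvable multiset w.r.t. (n,m) has size ≥ N.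
gAtLeast : ℕ → ℕ → ℕ → Set
gAtLeast n m N = Σ ℕ λ k → N ≤ k × Σ (Family m k) λ F → UniquelyResolvable n F

{-# OPTIONS --safe #-}
-- Take n distinct non-empty sets T₁,…,Tₙ ⊆ [m − 1] (binary expansions of 1,…,n) and a marker
-- point ∗. Let Bᵢ = Tᵢ and Aᵢ = [m] ∖ Tᵢ ∋ ∗, with classes {Aᵢ, Bᵢ}. In any resolution every
-- class covers ∗ and the Aᵢ pairwise meet in ∗, so each class holds exactly one A. Each class also
-- needs a B (its A misses a point), and there are as many B's as classes, so each class holds
-- exactly one B. A class {Aₐ, Bᵢ} then forces Bᵢ = [m] ∖ Aₐ = Bₐ, so a = i.
module Submission where

open import Defs
open import Data.Nat using (ℕ; zero; suc; _≤_; _<_; _∸_; _^_; _*_; _+_)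
open import Data.Nat.Properties using (≤-reflexive; +-identityʳ; +-comm; m≤o∸n⇒m+n≤o; m^n>0; n<1+n; 0≢1+n)
open import Data.Fin using (Fin; zero; suc; toℕ; splitAt; join; remQuot; combine; inject≤; punchOut)
open import Data.Fin.Properties
  using (_≟_; any?; <⇒notInjective; punchOut-injective; combine-remQuot; toℕ-↑ˡ; +↔⊎; join-splitAt;
         inject≤-injective; toℕ-inject≤; suc-injective)
open import Data.Fin.Subset using (Subset; Side; inside; outside; _∈_; _∉_; _⊆_; _∩_; ∁; Empty; Nonempty)
open import Data.Fin.Subset.Properties using (_∈?_; x∈p∩q⁺; x∈p∩q⁻; x∈∁p⇒x∉p; x∉p⇒x∈∁p; x∉∁p⇒x∈p; ⊆-antisym)
open import Data.Vec using ([]; _∷_; here; there)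
open import Data.Vec.Properties using (∷-injectiveˡ; ∷-injectiveʳ)
open import Data.Sum using (_⊎_; inj₁; inj₂; [_,_]′; reduce)
open import Data.Sum.Properties using (inj₁-injective)
open import Data.Product using (∃; _×_; _,_; proj₁; proj₂; uncurry)
import Data.Product as Product
open import Data.Empty using (⊥; ⊥-elim)
open import Relation.Nullary using (yes; no)
open import Relation.Binary.PropositionalEquality
open import Function using (_∘_; flip; _↔_; Inverse; Injective; mk⇔)

injective⇒surjective : ∀ {n} {f : Fin n → Fin n} → Injective _≡_ _≡_ f → Surjective f
injective⇒surjective {suc n} {f} f-injective y with any? (λ x → f x ≟ y)
... | yes hit = hit
... | no miss = ⊥-elim (<⇒notInjective (n<1+n n) squeeze-injective)
  where
  squeeze : Fin (suc n) → Fin n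
  squeeze x = punchOut {i = y} (λ y≡fx → miss (x , sym y≡fx))
  squeeze-injective : Injective _≡_ _≡_ squeeze
  squeeze-injective eq = f-injective (punchOut-injective {i = y} _ _ eq)

surjective⇒injective : ∀ {n} {f : Fin n → Fin n} → Surjective f → Injective _≡_ _≡_ f
surjective⇒injective {n} {f} f-surjective {x} {y} fx≡fy =
  trans (sym (r∘f x)) (trans (cong r fx≡fy) (r∘f y))
  where
  r : Fin n → Fin n
  r = proj₁ ∘ f-surjective
  f∘r : ∀ i → f (r i) ≡ i
  f∘r = proj₂ ∘ f-surjective
  r-surjective : Surjective r
  r-surjective = injective⇒surjective λ {i} {j} ri≡rj →
    trans (sym (f∘r i)) (trans (cong f ri≡rj) (f∘r j))
  r∘f : ∀ i → r (f i) ≡ i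
  r∘f i with i′ , refl ← r-surjective i = cong r (f∘r i′)

digit : Fin 2 → Side
digit zero    = outside
digit (suc _) = inside

digit-injective : Injective _≡_ _≡_ digit
digit-injective {zero}     {zero}     _ = refl
digit-injective {suc zero} {suc zero} _ = refl

bits : ∀ m → Fin (2 ^ m) → Subset m
bits zero    _ = []
bits (suc m) i = digit (proj₁ (remQuot {2} (2 ^ m) i)) ∷ bits m (proj₂ (remQuot {2} (2 ^ m) i))

bits-injective : ∀ m {i j : Fin (2 ^ m)} → bits m i ≡ bits m j → i ≡ j
bits-injective zero    {zero} {zero} _ = refl
bits-injective (suc m) {i} {j} eq = begin
  i                                         ≡⟨ combine-remQuot {2} (2 ^ m) i ⟨
  uncurry combine (remQuot {2} (2 ^ m) i)   ≡⟨ cong₂ combine (digit-injective (∷-injectiveˡ eq))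
                                                              (bits-injective m (∷-injectiveʳ eq)) ⟩
  uncurry combine (remQuot {2} (2 ^ m) j)   ≡⟨ combine-remQuot {2} (2 ^ m) j ⟩
  j                                         ∎
  where open ≡-Reasoning

bits-nonempty : ∀ m {i : Fin (2 ^ m)} → toℕ i ≢ 0 → Nonempty (bits m i)
bits-nonempty zero    {zero} i≢0 = ⊥-elim (i≢0 refl)
bits-nonempty (suc m) {i} i≢0 with remQuot {2} (2 ^ m) i in i↦br
... | b , r =
  subst Nonempty (sym (cong (λ (b , r) → digit b ∷ bits m r) i↦br)) (digits-nonempty b r i≡br)
  where
  i≡br : combine b r ≡ i
  i≡br = trans (cong (uncurry combine) (sym i↦br)) (combine-remQuot {2} (2 ^ m) i)
  digits-nonempty : ∀ b r → combine b r ≡ i → Nonempty (digit b ∷ bits m r)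
  digits-nonempty (suc _) r _   = zero , here
  digits-nonempty zero    r r≡i = Product.map suc there (bits-nonempty m λ r≡0 →
    i≢0 (trans (cong toℕ (sym r≡i)) (trans (toℕ-↑ˡ r _) r≡0)))

module _ {m n : ℕ} (n<2^m : n < 2 ^ m) where

  nonzeroBits : Fin n → Subset m
  nonzeroBits i = bits m (inject≤ (suc i) n<2^m)

  nonzeroBits-injective : Injective _≡_ _≡_ nonzeroBits
  nonzeroBits-injective eq = suc-injective (inject≤-injective n<2^m n<2^m _ _ (bits-injective m eq))

  nonzeroBits-nonempty : ∀ i → Nonempty (nonzeroBits i)
  nonzeroBits-nonempty i = bits-nonempty m λ eq → 0≢1+n (trans (sym eq) (toℕ-inject≤ (suc i) n<2^m))

IsIndexedResolution : ∀ {m} {I : Set} n → (I → Subset m) → (I → Fin n) → Set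
IsIndexedResolution {m} {I} n F c =
  (∀ i → ∃ λ s → c s ≡ i) ×
  (∀ (i : Fin n) →
     (∀ (s t : I) → s ≢ t → c s ≡ i → c t ≡ i → Empty (F s ∩ F t)) ×
     (∀ (x : Fin m) → ∃ λ s → c s ≡ i × x ∈ F s))

module _ {J I : Set} (e : J ↔ I) {m n : ℕ} {F : I → Subset m} where
  open Inverse e

  resolution-∘to : ∀ {c} → IsIndexedResolution n F c → IsIndexedResolution n (F ∘ to) (c ∘ to)
  resolution-∘to {c} (c-surjective , c-resolves) = surjective , λ i → disjoint i , covers i
    where
    surjective : ∀ i → ∃ λ j → c (to j) ≡ i
    surjective i with s , cs≡i ← c-surjective i = from s , trans (cong c (strictlyInverseˡ s)) cs≡i
    disjoint : ∀ i j j′ → j ≢ j′ → c (to j) ≡ i → c (to j′) ≡ i → Empty (F (to j) ∩ F (to j′))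
    disjoint i j j′ j≢j′ = proj₁ (c-resolves i) (to j) (to j′) λ eq →
      j≢j′ (trans (sym (strictlyInverseʳ j)) (trans (cong from eq) (strictlyInverseʳ j′)))
    covers : ∀ i x → ∃ λ j → c (to j) ≡ i × x ∈ F (to j)
    covers i x with s , cs≡i , x∈Fs ← proj₂ (c-resolves i) x =
      from s , trans (cong c (strictlyInverseˡ s)) cs≡i ,
      subst (x ∈_) (cong F (sym (strictlyInverseˡ s))) x∈Fs

  resolution-∘from : ∀ {c} → IsIndexedResolution n (F ∘ to) c → IsIndexedResolution n F (c ∘ from)
  resolution-∘from {c} (c-surjective , c-resolves) = surjective , λ i → disjoint i , covers i
    where
    surjective : ∀ i → ∃ λ s → c (from s) ≡ i
    surjective i with j , cj≡i ← c-surjective i = to j , trans (cong c (strictlyInverseʳ j)) cj≡i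
    disjoint : ∀ i s t → s ≢ t → c (from s) ≡ i → c (from t) ≡ i → Empty (F s ∩ F t)
    disjoint i s t s≢t cs≡i ct≡i =
      subst₂ (λ p q → Empty (F p ∩ F q)) (strictlyInverseˡ s) (strictlyInverseˡ t)
        (proj₁ (c-resolves i) (from s) (from t) (λ eq → s≢t (trans (sym (strictlyInverseˡ s))
                                                   (trans (cong to eq) (strictlyInverseˡ t))))
          cs≡i ct≡i)
    covers : ∀ i x → ∃ λ s → c (from s) ≡ i × x ∈ F s
    covers i x with j , cj≡i , x∈Fj ← proj₂ (c-resolves i) x =
      to j , trans (cong c (strictlyInverseʳ j)) cj≡i , x∈Fj

samePartition-∘ : ∀ {k n} {c c′ : Fin k → Fin n} {f : Fin n → Fin n} →
                  Injective _≡_ _≡_ f → (∀ j → c′ j ≡ f (c j)) → SamePartition c c′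
samePartition-∘ {c = c} {c′} {f} f-injective c′≗f∘c j j′ = mk⇔
  (λ cj≡cj′ → trans (c′≗f∘c j) (trans (cong f cj≡cj′) (sym (c′≗f∘c j′))))
  (λ c′j≡c′j′ → f-injective (trans (sym (c′≗f∘c j)) (trans c′j≡c′j′ (c′≗f∘c j′))))

module Construction {m n : ℕ} (T : Fin n → Subset m)
                    (T-injective : Injective _≡_ _≡_ T) (T-nonempty : ∀ i → Nonempty (T i)) where

  -- position zero is the marker ∗
  B A : Fin n → Subset (suc m)
  B i = outside ∷ T i
  A i = ∁ (B i)

  member : Fin n ⊎ Fin n → Subset (suc m)
  member = [ A , B ]′

  family : Family (suc m) (n + n)
  family = member ∘ splitAt n

  A-B-disjoint : ∀ {i x} → x ∈ A i → x ∉ B i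
  A-B-disjoint = x∈∁p⇒x∉p

  B-injective : Injective _≡_ _≡_ B
  B-injective = T-injective ∘ ∷-injectiveʳ

  member-nonempty : ∀ s → Nonempty (member s)
  member-nonempty (inj₁ i) = zero , here
  member-nonempty (inj₂ i) = Product.map suc there (T-nonempty i)

  reduce-resolution : IsIndexedResolution n member reduce
  reduce-resolution = (λ i → inj₁ i , refl) , λ i → disjoint i , covers i
    where
    disjoint : ∀ i s t → s ≢ t → reduce s ≡ i → reduce t ≡ i → Empty (member s ∩ member t)
    disjoint _ (inj₁ _) (inj₁ _) s≢t refl refl = ⊥-elim (s≢t refl)
    disjoint _ (inj₂ _) (inj₂ _) s≢t refl refl = ⊥-elim (s≢t refl)
    disjoint _ (inj₁ i) (inj₂ _) _ refl refl (_ , x∈A∩B) = uncurry A-B-disjoint (x∈p∩q⁻ (A i) (B i) x∈A∩B)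
    disjoint _ (inj₂ i) (inj₁ _) _ refl refl (_ , x∈B∩A) = uncurry (flip A-B-disjoint) (x∈p∩q⁻ (B i) (A i) x∈B∩A)
    covers : ∀ i x → ∃ λ s → reduce s ≡ i × x ∈ member s
    covers i x with x ∈? B i
    ... | yes x∈B = inj₂ i , refl , x∈B
    ... | no  x∉B = inj₁ i , refl , x∉p⇒x∈∁p x∉B

  module _ {κ : Fin n ⊎ Fin n → Fin n} (κ-resolution : IsIndexedResolution n member κ) where

    α β : Fin n → Fin n
    α = κ ∘ inj₁
    β = κ ∘ inj₂

    private
      covers : ∀ l x → ∃ λ s → κ s ≡ l × x ∈ member s
      covers l = proj₂ (proj₂ κ-resolution l)

      apart : ∀ {s t x} → s ≢ t → κ s ≡ κ t → x ∈ member s → x ∈ member t → ⊥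
      apart {s} {t} s≢t κs≡κt x∈s x∈t =
        proj₁ (proj₂ κ-resolution (κ t)) s t s≢t κs≡κt refl (_ , x∈p∩q⁺ (x∈s , x∈t))

    α-injective : Injective _≡_ _≡_ α
    α-injective {a} {a′} αa≡αa′ with a ≟ a′
    ... | yes a≡a′ = a≡a′
    ... | no  a≢a′ = ⊥-elim (apart (a≢a′ ∘ inj₁-injective) αa≡αa′ here here)

    α-surjective : Surjective α
    α-surjective l with covers l zero
    ... | inj₁ a , αa≡l , _ = a , αa≡l
    ... | inj₂ _ , _    , ()

    B-covered : ∀ {a x} → x ∈ B a → ∃ λ b → β b ≡ α a × x ∈ B b
    B-covered {a} {x} x∈Ba with covers (α a) x
    ... | inj₂ b  , βb≡αa  , x∈Bb  = b , βb≡αa , x∈Bb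
    ... | inj₁ a′ , αa′≡αa , x∈Aa′ with refl ← α-injective αa′≡αa = ⊥-elim (A-B-disjoint x∈Aa′ x∈Ba)

    β-surjective : Surjective β
    β-surjective l with a , refl ← α-surjective l =
      Product.map₂ proj₁ (B-covered (proj₂ (member-nonempty (inj₂ a))))

    β-injective : Injective _≡_ _≡_ β
    β-injective = surjective⇒injective β-surjective

    α≗β : ∀ i → α i ≡ β i
    α≗β i with a , αa≡βi ← α-surjective (β i) =
      subst (λ a → α a ≡ β i) (B-injective (⊆-antisym Ba⊆Bi Bi⊆Ba)) αa≡βi
      where
      Ba⊆Bi : B a ⊆ B i
      Ba⊆Bi x∈Ba with b , βb≡αa , x∈Bb ← B-covered x∈Ba
        with refl ← β-injective (trans βb≡αa αa≡βi) = x∈Bb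
      Bi⊆Ba : B i ⊆ B a
      Bi⊆Ba x∈Bi = x∉∁p⇒x∈p λ x∈Aa → apart (λ ()) αa≡βi x∈Aa x∈Bi

    κ≗α∘reduce : ∀ s → κ s ≡ α (reduce s)
    κ≗α∘reduce (inj₁ a) = refl
    κ≗α∘reduce (inj₂ b) = sym (α≗β b)

  uniquelyResolvable : UniquelyResolvable n family
  uniquelyResolvable =
    member-nonempty ∘ splitAt n , reduce ∘ splitAt n , resolution-∘to +↔⊎ reduce-resolution , unique
    where
    unique : ∀ c′ → IsResolution n family c′ → SamePartition (reduce ∘ splitAt n) c′
    unique c′ c′-resolution = samePartition-∘ (α-injective κ-resolution) λ j →
      trans (cong c′ (sym (join-splitAt n n j))) (κ≗α∘reduce κ-resolution (splitAt n j))
      where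
      κ-resolution : IsIndexedResolution n member (c′ ∘ join n n)
      κ-resolution = resolution-∘from +↔⊎ c′-resolution

lemma15 : (n m : ℕ) → 1 ≤ n → 1 ≤ m → n ≤ 2 ^ (m ∸ 1) ∸ 1 →
          gAtLeast n m (2 * n)
lemma15 n zero    _ () _
lemma15 n (suc m) _ _ n≤2^m∸1 =
  n + n , ≤-reflexive (cong (n +_) (+-identityʳ n)) , family , uniquelyResolvable
  where
  n<2^m : n < 2 ^ m
  n<2^m = subst (_≤ 2 ^ m) (+-comm n 1) (m≤o∸n⇒m+n≤o n (m^n>0 2 m) n≤2^m∸1)
  open Construction (nonzeroBits {m} n<2^m) (nonzeroBits-injective n<2^m) (nonzeroBits-nonempty n<2^m)
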